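{- Let $\Sigma$ be a finite alphabet, let $\Phi$ be a formula with a single free first-order variable $x$, let $L_\Phi\subseteq(\Sigma\times\{0,1\})^*$ be the language of $\{x\}$-structures satisfying $\Phi$, and let $L_{\exists x.\Phi}=\pi[\gamma_1^{ -1}(L_\Phi)]\subseteq\Sigma^*$. If $\tau\colon(\Sigma\times\{0,1\})^*\to M$ is a monoid morphism recognising $L_\Phi$, then there exists a monoid morphism $\xi\colon\Sigma^*\to \Diamond M$ that recognises $L_{\exists x.\Phi}$ and satisfies $\pi_2\circ\xi=\tau\circ\gamma_0$, where $\pi_2\colon\Diamond M\to M$ is the projection on the second coordinate.
   Context: Words $w=w_0\cdots w_{|w|-1}\in\Sigma^*$ are seen as finite structures with positions $0,\dots,|w|-1$ and letter predicates. Let $\Sigma^*\otimes\mathbb{N}=\{(w,i)\in\Sigma^*\times\mathbb{N}\mid i<|w|\}$ (words with a marked position). Define $\gamma_0\colon\Sigma^*\to(\Sigma\times\{0,1\})^*$ by $w\mapsto w^0$ with $(w^0)_j=(w_j,0)$; $\gamma_1\colon\Sigma^*\otimes\mathbb{N}\to(\Sigma\times\{0,1\})^*$ by $(w,i)\mapsto w^{(i)}$ with $(w^{(i)})_j=(w_j,0)$ for $j\neq i$ and $(w^{(i)})_i=(w_i,1)$; and $\pi\colon\Sigma^*\otimes\mathbb{N}\to\Sigma^*$ the first projection. An $\{x\}$-structure is a word of the form $w^{(i)}$; it satisfies $\Phi$ if $w$ satisfies $\Phi$ with $x$ interpreted as position $i$. A monoid morphism $h\colon A^*\to M$ recognises $L\subseteq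 A^*$ if $L=h^{ -1}(V)$ for some $V\subseteq M$. For a monoid $M$, the unary Schützenberger product $\Diamond M$ is the monoid with underlying set $\mathcal{P}_{\mathrm{fin}}(M)\times M$ ($\mathcal{P}_{\mathrm{fin}}(M)$ the finite subsets of $M$) and multiplication $(S,m)*(T,n)=(S\cdot n\cup m\cdot T,\ m\cdot n)$, where $S\cdot n=\{s n\mid s\in S\}$ and $m\cdot T=\{mt\mid t\in T\}$. -}

module Defs where

open import Level using (Level; _⊔_; 0ℓ) renaming (suc to lsuc)
open import Data.Bool using (Bool; true; false)
open import Data.Nat using (ℕ)
open import Data.Fin using (Fin; zero; suc)
open import Data.List using (List; []; _∷_; _++_; map; length)
open import Data.Product using (Σ; Σ-syntax; _×_; _,_; proj₁; proj₂)
open import Relation.Binary.PropositionalEquality using (_≡_)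
open import Algebra.Bundles using (Monoid)
open import Algebra.Bundles.Raw using (RawMonoid)
import Data.List.Membership.Setoid as SetoidMembership

Language : Set → Set₁
Language A = List A → Set

WordPos : Set → Set
WordPos A = Σ[ w ∈ List A ] Fin (length w)

π : {A : Set} → WordPos A → List A
π = proj₁

γ₀ : {A : Set} → List A → List (A × Bool)
γ₀ = map (λ a → a , false)

mark : {A : Set} (w : List A) → Fin (length w) → List (A × Bool)
mark (a ∷ w) zero    = (a , true) ∷ γ₀ w
mark (a ∷ w) (suc i) = (a , false) ∷ mark w i

γ₁ : {A : Set} → WordPos A → List (A × Bool)
γ₁ (w , i) = mark w i

-- A formula with one free first-order variable x, given by its semantics:
-- Sat w i  means  w ⊨ Φ with x interpreted as position i.
FormulaSem : Set → Set₁
FormulaSem A = (w : List A) → Fin (length w) → Set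

L[_] : {A : Set} → FormulaSem A → Language (A × Bool)
L[ Φ ] u = Σ[ p ∈ WordPos _ ] (u ≡ γ₁ p) × Φ (proj₁ p) (proj₂ p)

L∃[_] : {A : Set} → FormulaSem A → Language A
L∃[ Φ ] w = Σ[ p ∈ WordPos _ ] L[ Φ ] (γ₁ p) × (π p ≡ w)

record IsFreeMorphism {c ℓ} {A : Set} (M : RawMonoid c ℓ)
                      (h : List A → RawMonoid.Carrier M) : Set (c ⊔ ℓ) where
  open RawMonoid M
  field
    h-ε : h [] ≈ ε
    h-∙ : ∀ u v → h (u ++ v) ≈ h u ∙ h v

Recognises : ∀ {c ℓ} {A : Set} (M : RawMonoid c ℓ)
             (h : List A → RawMonoid.Carrier M) → Language A → Set (lsuc 0ℓ ⊔ c ⊔ ℓ)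
Recognises M h L =
  Σ[ V ∈ (Carrier → Set) ]
    (∀ {x y} → x ≈ y → V x → V y) ×
    (∀ u → (L u → V (h u)) × (V (h u) → L u))
  where open RawMonoid M

-- Unary Schützenberger product ◇M : P_fin(M) × M, finite subsets as lists
-- up to having the same elements (w.r.t. ≈ of M).
module _ {c ℓ} (M : Monoid c ℓ) where
  open Monoid M
  open SetoidMembership setoid using (_∈_)

  _≈fin_ : List Carrier → List Carrier → Set (c ⊔ ℓ)
  S ≈fin T = ∀ x → (x ∈ S → x ∈ T) × (x ∈ T → x ∈ S)

  ◇ : RawMonoid c (c ⊔ ℓ)
  ◇ = record
    { Carrier = List Carrier × Carrier
    ; _≈_     = λ p q → (proj₁ p ≈fin proj₁ q) × (proj₂ p ≈ proj₂ q)
    ; _∙_     = λ p q → ( map (λ s → s ∙ proj₂ q) (proj₁ p)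
                          ++ map (λ t → proj₂ p ∙ t) (proj₁ q)
                        , proj₂ p ∙ proj₂ q )
    ; ε       = [] , ε
    }

-- A word w is sent to the pair (the set of all τ(w^{(i)}), τ(w⁰)).  Marking
-- a position of uv marks a position of u, leaving v unmarked, or one of v,
-- leaving u unmarked; so the marked images of uv are those of u multiplied on
-- the right by τ(v⁰) together with those of v multiplied on the left by
-- τ(u⁰), which is exactly the multiplication of ◇M.  Since w ∈ L_{∃x.Φ} iff
-- some marking of w lies in L_Φ, i.e. iff some τ(w^{(i)}) lies in the
-- accepting set V of τ, the morphism recognises L_{∃x.Φ} with the accepting
-- set {(S, m) | S meets V}.
module Submission where

open import Defs
open import Level using (_⊔_)
open import Data.Nat using (ℕ)
open import Data.Fin using (Fin)
open import Data.Bool using (Bool; true; false)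
open import Data.List using (List; []; _∷_; _++_; map; lookup; tabulate)
open import Data.List.Properties using (map-++; map-∘; map-id; map-tabulate)
open import Data.List.Relation.Unary.Any using (Any; index)
open import Data.List.Relation.Binary.Pointwise using ([]; _∷_)
open import Data.List.Relation.Unary.Any.Properties using (lookup-index; map⁺; map⁻; tabulate⁺; tabulate⁻)
open import Data.Product using (Σ-syntax; _×_; _,_; proj₁; proj₂)
open import Function using (_∘_; id)
open import Relation.Binary.PropositionalEquality using (_≡_; refl; sym; cong; cong₂; module ≡-Reasoning)
open import Algebra.Bundles using (Monoid)
open import Relation.Binary.Bundles using (Setoid)
import Data.List.Relation.Binary.Equality.Setoid as SetoidEquality
import Data.List.Membership.Setoid as SetoidMembership
open import Data.List.Membership.Setoid.Properties using (∈-resp-≋; ∈-lookup)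
import Relation.Binary.Reasoning.Setoid

marks : {A : Set} → List A → List (List (A × Bool))
marks w = tabulate (mark w)

marks-++ : {A : Set} (u v : List A) →
  marks (u ++ v) ≡ map (_++ γ₀ v) (marks u) ++ map (γ₀ u ++_) (marks v)
marks-++ [] v = sym (map-id (marks v))
marks-++ (a ∷ u) v = cong₂ _∷_ (cong ((a , true) ∷_) (map-++ _ u v)) (begin
  tabulate (cons ∘ mark (u ++ v))
    ≡⟨ map-tabulate (mark (u ++ v)) cons ⟨
  map cons (marks (u ++ v))
    ≡⟨ cong (map cons) (marks-++ u v) ⟩
  map cons (map (_++ γ₀ v) (marks u) ++ map (γ₀ u ++_) (marks v))
    ≡⟨ map-++ cons (map (_++ γ₀ v) (marks u)) (map (γ₀ u ++_) (marks v)) ⟩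
  map cons (map (_++ γ₀ v) (marks u)) ++ map cons (map (γ₀ u ++_) (marks v))
    ≡⟨ cong₂ _++_ (sym (map-∘ (marks u))) (sym (map-∘ (marks v))) ⟩
  map (λ m → cons (m ++ γ₀ v)) (marks u) ++ map (cons ∘ (γ₀ u ++_)) (marks v)
    ≡⟨ cong (_++ map (cons ∘ (γ₀ u ++_)) (marks v)) (map-∘ (marks u)) ⟩
  map (_++ γ₀ v) (map cons (marks u)) ++ map (cons ∘ (γ₀ u ++_)) (marks v)
    ≡⟨ cong (λ ms → map (_++ γ₀ v) ms ++ map (cons ∘ (γ₀ u ++_)) (marks v)) (map-tabulate (mark u) cons) ⟩
  map (_++ γ₀ v) (tabulate (cons ∘ mark u)) ++ map (cons ∘ (γ₀ u ++_)) (marks v)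
    ∎)
  where
  open ≡-Reasoning
  cons = (a , false) ∷_

module _ {c ℓ} (S : Setoid c ℓ) where
  open Setoid S
  open SetoidEquality S using (_≋_; ≋-sym)
  open SetoidMembership S using (_∈_; lose)

  map-≋ : {B : Set} {f g : B → Carrier} → (∀ b → f b ≈ g b) →
          ∀ bs → map f bs ≋ map g bs
  map-≋ f≈g []       = []
  map-≋ f≈g (b ∷ bs) = f≈g b ∷ map-≋ f≈g bs

  SameElements : List Carrier → List Carrier → Set (c ⊔ ℓ)
  SameElements xs ys = ∀ x → (x ∈ xs → x ∈ ys) × (x ∈ ys → x ∈ xs)

  ≋⇒SameElements : ∀ {xs ys} → xs ≋ ys → SameElements xs ys
  ≋⇒SameElements xs≋ys x = ∈-resp-≋ S xs≋ys , ∈-resp-≋ S (≋-sym xs≋ys)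

  -- Unlike Any V xs, which lives in Set c, this stays in Set as Recognises demands.
  Meets : (Carrier → Set) → List Carrier → Set
  Meets V xs = Σ[ i ∈ Fin _ ] V (lookup xs i)

  module _ {V : Carrier → Set} (V-resp : ∀ {x y} → x ≈ y → V x → V y) where

    Any⇒Meets : ∀ {xs} → Any V xs → Meets V xs
    Any⇒Meets p = index p , lookup-index p

    Meets⇒Any : ∀ {xs} → Meets V xs → Any V xs
    Meets⇒Any {xs} (i , v) = lose V-resp (∈-lookup S xs i) v

    Meets-resp-SameElements : ∀ {xs ys} → SameElements xs ys → Meets V xs → Meets V ys
    Meets-resp-SameElements {xs} same (i , v) =
      Any⇒Meets (lose V-resp (proj₁ (same _) (∈-lookup S xs i)) v)

module Diamond {c ℓ} {A : Set} (M : Monoid c ℓ)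
  (τ : List (A × Bool) → Monoid.Carrier M)
  (τ-hom : IsFreeMorphism (Monoid.rawMonoid M) τ) where
  open Monoid M hiding (refl)
  open IsFreeMorphism τ-hom
  open SetoidEquality setoid using (_≋_; ≋-setoid; ++⁺)

  ξ : List A → List Carrier × Carrier
  ξ w = map τ (marks w) , τ (γ₀ w)

  τ-γ₀-++ : ∀ u v → τ (γ₀ (u ++ v)) ≈ τ (γ₀ u) ∙ τ (γ₀ v)
  τ-γ₀-++ u v = trans (reflexive (cong τ (map-++ _ u v))) (h-∙ (γ₀ u) (γ₀ v))

  τ-marks-++ : ∀ u v → map τ (marks (u ++ v)) ≋
    map (_∙ τ (γ₀ v)) (map τ (marks u)) ++ map (τ (γ₀ u) ∙_) (map τ (marks v))
  τ-marks-++ u v = begin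
    map τ (marks (u ++ v))
      ≡⟨ cong (map τ) (marks-++ u v) ⟩
    map τ (map (_++ γ₀ v) (marks u) ++ map (γ₀ u ++_) (marks v))
      ≡⟨ map-++ τ (map (_++ γ₀ v) (marks u)) (map (γ₀ u ++_) (marks v)) ⟩
    map τ (map (_++ γ₀ v) (marks u)) ++ map τ (map (γ₀ u ++_) (marks v))
      ≡⟨ cong₂ _++_ (map-∘ (marks u)) (map-∘ (marks v)) ⟨
    map (τ ∘ (_++ γ₀ v)) (marks u) ++ map (τ ∘ (γ₀ u ++_)) (marks v)
      ≈⟨ ++⁺ (map-≋ setoid (λ m → h-∙ m (γ₀ v)) (marks u))
             (map-≋ setoid (λ m → h-∙ (γ₀ u) m) (marks v)) ⟩
    map ((_∙ τ (γ₀ v)) ∘ τ) (marks u) ++ map ((τ (γ₀ u) ∙_) ∘ τ) (marks v)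
      ≡⟨ cong₂ _++_ (map-∘ (marks u)) (map-∘ (marks v)) ⟩
    map (_∙ τ (γ₀ v)) (map τ (marks u)) ++ map (τ (γ₀ u) ∙_) (map τ (marks v))
      ∎
    where open Relation.Binary.Reasoning.Setoid ≋-setoid

  ξ-isFreeMorphism : IsFreeMorphism (◇ M) ξ
  ξ-isFreeMorphism = record
    { h-ε = (λ _ → id , id) , h-ε
    ; h-∙ = λ u v → ≋⇒SameElements setoid (τ-marks-++ u v) , τ-γ₀-++ u v
    }

  ξ-recognises : (Φ : FormulaSem A) → Recognises (Monoid.rawMonoid M) τ L[ Φ ] →
                 Recognises (◇ M) ξ L∃[ Φ ]
  ξ-recognises Φ (V , V-resp , τ-recognises) =
    (λ p → Meets setoid V (proj₁ p)) ,
    (λ p≈q → Meets-resp-SameElements setoid V-resp (proj₁ p≈q)) ,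
    (λ w → accept w , reject w)
    where
    accept : ∀ w → L∃[ Φ ] w → Meets setoid V (map τ (marks w))
    accept _ ((w , i) , wⁱ∈L , refl) =
      Any⇒Meets setoid V-resp (map⁺ (tabulate⁺ i (proj₁ (τ-recognises (mark w i)) wⁱ∈L)))

    reject : ∀ w → Meets setoid V (map τ (marks w)) → L∃[ Φ ] w
    reject w meets with tabulate⁻ (map⁻ (Meets⇒Any setoid V-resp meets))
    ... | i , τwⁱ∈V = (w , i) , proj₂ (τ-recognises (mark w i)) τwⁱ∈V , refl

proposition4p4 : ∀ {c ℓ} (k : ℕ) (Φ : FormulaSem (Fin k)) (M : Monoid c ℓ)
    (τ : List (Fin k × Bool) → Monoid.Carrier M) →
    IsFreeMorphism (Monoid.rawMonoid M) τ →
    Recognises (Monoid.rawMonoid M) τ L[ Φ ] →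
    Σ[ ξ ∈ (List (Fin k) → List (Monoid.Carrier M) × Monoid.Carrier M) ]
      IsFreeMorphism (◇ M) ξ × Recognises (◇ M) ξ L∃[ Φ ] ×
      (∀ w → Monoid._≈_ M (proj₂ (ξ w)) (τ (γ₀ w)))
proposition4p4 k Φ M τ τ-hom τ-recognises =
  ξ , ξ-isFreeMorphism , ξ-recognises Φ τ-recognises , λ _ → Monoid.refl M
  where open Diamond M τ τ-hom
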